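{- Let $T$ be a tree and let $S=\{v\in V(T)\mid \eta(v)=\mathfrak{H}(T)\}$. Then all vertices of $S$ lie on a common path of $T$.
   Context: For a vertex $v$ of a tree $T$, the components of $T-\{v\}$ are its maximal connected subgraphs; for such a component $C(v)$, $\operatorname{reach}(C(v))=\max\{d(v,u)\mid u\in V(C(v))\cup\{v\}\}$. Denote the components of $T-\{v\}$ by $C_1(v),\dots,C_{\deg(v)}(v)$ with $\operatorname{reach}(C_i(v))\ge\operatorname{reach}(C_{i+1}(v))$. The triod size of $v$ is $\eta(v)=\operatorname{reach}(C_3(v))$ if $\deg(v)\ge 3$ and $\eta(v)=0$ if $\deg(v)\le 2$; the triod size of $T$ is $\mathfrak{H}(T)=\max\{\eta(v)\mid v\in V(T)\}$. -}

module Defs where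

open import Data.Nat using (ℕ; zero; suc; _≤_; _≥_)
open import Data.Fin using (Fin)
open import Data.Fin.Subset using (Subset; _∈_; _∉_)
open import Data.List using (List; []; _∷_; length)
import Data.List.Membership.Propositional as L
open import Data.List.Relation.Unary.All using (All)
open import Data.List.Relation.Unary.Unique.Propositional using (Unique)
open import Data.List.Relation.Unary.Linked using (Linked)
open import Data.List.Relation.Binary.Pointwise using (Pointwise)
open import Data.Product using (Σ; ∃; _×_; _,_)
open import Data.Sum using (_⊎_)
open import Data.Unit using (⊤)
open import Data.Empty using (⊥)
open import Relation.Nullary using (¬_)
open import Relation.Binary.PropositionalEquality using (_≡_; _≢_)

record Graph (n : ℕ) : Set₁ where
  field
    Adj     : Fin n → Fin n → Set
    symm    : ∀ {u w} → Adj u w → Adj w u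
    irrefl  : ∀ {u} → ¬ Adj u u
open Graph public

module _ {n : ℕ} (G : Graph n) where

  data WalkIn (P : Fin n → Set) : Fin n → Fin n → ℕ → Set where
    here : ∀ {u} → P u → WalkIn P u u zero
    step : ∀ {u w x k} → P u → Adj G u w → WalkIn P w x k → WalkIn P u x (suc k)

  Walk : Fin n → Fin n → ℕ → Set
  Walk = WalkIn (λ _ → ⊤)

  data Chain : List (Fin n) → Set where
    nil  : Chain []
    one  : ∀ {u} → Chain (u ∷ [])
    cons : ∀ {u w vs} → Adj G u w → Chain (w ∷ vs) → Chain (u ∷ w ∷ vs)

  IsPath : List (Fin n) → Set
  IsPath vs = Unique vs × Chain vs

  IsCycle : List (Fin n) → Set
  IsCycle []               = ⊥
  IsCycle (u ∷ [])         = ⊥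
  IsCycle (u ∷ w ∷ [])     = ⊥
  IsCycle (u ∷ w ∷ x ∷ vs) = IsPath (u ∷ w ∷ x ∷ vs) × Adj G (lastOf x vs) u
    where
      lastOf : Fin n → List (Fin n) → Fin n
      lastOf y []       = y
      lastOf y (z ∷ zs) = lastOf z zs

  Connected : Set
  Connected = ∀ u w → ∃ λ k → Walk u w k

  -- A tree: a nonempty connected acyclic graph.
  IsTree : Set
  IsTree = Fin n × Connected × (∀ vs → ¬ IsCycle vs)

  Dist : Fin n → Fin n → ℕ → Set
  Dist u w k = Walk u w k × (∀ j → Walk u w j → k ≤ j)

  -- C is a component of T - {v}: a maximal connected subgraph of T - {v}
  -- (vertex set C, nonempty, v ∉ C, connected inside C, and no edge of T - {v}
  -- leaves C).
  IsComponent : Fin n → Subset n → Set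
  IsComponent v C =
    (∃ λ u → u ∈ C) × v ∉ C
    × (∀ a b → a ∈ C → b ∈ C → ∃ λ k → WalkIn (λ x → x ∈ C) a b k)
    × (∀ a b → a ∈ C → b ∉ C → b ≢ v → ¬ Adj G a b)

  Reach : Fin n → Subset n → ℕ → Set
  Reach v C r =
    (∃ λ u → (u ∈ C ⊎ u ≡ v) × Dist v u r)
    × (∀ u k → (u ∈ C ⊎ u ≡ v) → Dist v u k → k ≤ r)

  ComponentsOrdered : Fin n → List (Subset n) → List ℕ → Set
  ComponentsOrdered v Cs rs =
    Unique Cs × All (IsComponent v) Cs
    × (∀ C → IsComponent v C → C L.∈ Cs)
    × Pointwise (Reach v) Cs rs
    × Linked _≥_ rs

  -- third element of the list of reaches, or 0 if there are fewer than three
  -- (there are exactly deg(v) components of T - {v}).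
  third : List ℕ → ℕ
  third (_ ∷ _ ∷ c ∷ _) = c
  third _               = 0

  Eta : Fin n → ℕ → Set
  Eta v k = ∃ λ Cs → ∃ λ rs → ComponentsOrdered v Cs rs × k ≡ third rs

  TriodSize : ℕ → Set
  TriodSize h = (∃ λ v → Eta v h) × (∀ v k → Eta v k → k ≤ h)

{-# OPTIONS --safe #-}
module Submission where

-- Take a diametral path a ─ b and suppose some v with η v = 𝔥 lies off it; let w be the vertex of
-- the path nearest to v. Of the two components of T - v of largest reach at least one avoids w, so
-- some y lies beyond v as seen from w with d(v, y) ≥ 𝔥, whence d(w, y) > 𝔥. Since d(a, b) is
-- maximal, d(w, a) and d(w, b) are at least d(w, y). Now a, b and y lie in three different
-- components of T - w, each of reach > 𝔥, so η w > 𝔥: a contradiction.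

open import Data.Bool as Bool using ()
open import Data.Empty using (⊥-elim)
open import Data.Fin using (Fin) renaming (_≟_ to _≟ᶠ_)
open import Data.Fin.Subset using (Subset) renaming (_∈_ to _∈ₛ_; _∉_ to _∉ₛ_)
open import Data.Fin.Subset.Properties using (⊆-antisym) renaming (_∈?_ to _∈ₛ?_)
open import Data.List as List using (List; []; _∷_; allFin; filter; deduplicate)
open import Data.List.Extrema.Nat
  using (argmax; argmax-all; f[xs]≤f[argmax]; f[⊥]≤f[argmax]; argmin; argmin-sel; f[argmin]≤f[xs])
open import Data.List.Membership.Propositional using (_∈_; _∉_)
open import Data.List.Membership.Propositional.Properties
  using (∈-allFin; ∈-filter⁺; ∈-filter⁻; ∈-map⁺; ∈-map⁻; ∈-deduplicate⁺; ∈-deduplicate⁻)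
open import Data.List.Relation.Binary.Permutation.Propositional using (↭-sym; ↭⇒↭ₛ)
open import Data.List.Relation.Binary.Permutation.Propositional.Properties using (∈-resp-↭)
open import Data.List.Relation.Binary.Permutation.Setoid.Properties using (Unique-resp-↭)
open import Data.List.Relation.Binary.Pointwise using (Pointwise; []; _∷_)
open import Data.List.Relation.Binary.Subset.Propositional using (_⊆_)
open import Data.List.Relation.Unary.All as All using (All; []; _∷_)
open import Data.List.Relation.Unary.All.Properties using (¬Any⇒All¬; All¬⇒¬Any)
open import Data.List.Relation.Unary.AllPairs using ([]; _∷_)
open import Data.List.Relation.Unary.Any using (here; there)
open import Data.List.Relation.Unary.Linked using (Linked; _∷_)
import Data.List.Relation.Unary.Linked.Properties as Linked
open import Data.List.Relation.Unary.Unique.DecPropositional.Properties using (deduplicate-!)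
open import Data.List.Relation.Unary.Unique.Propositional using (Unique)
import Data.List.Sort as Sort
open import Data.Nat using (ℕ; zero; suc; _+_; _≤_; _<_; _≥_; z≤n; s≤s)
open import Data.Nat.Properties
open import Data.Product using (Σ; ∃; ∃₂; _×_; _,_; proj₁; proj₂)
open import Data.Sum using (_⊎_; inj₁; inj₂; [_,_]′)
open import Data.Unit using (tt)
import Data.Vec as Vec
open import Data.Vec.Properties using (≡-dec; lookup∘tabulate; []=⇒lookup; lookup⇒[]=)
open import Function using (_∘_; id)
open import Relation.Binary.Construct.Closure.ReflexiveTransitive using (Star; ε; _◅_; _◅◅_; revApp; reverse)
import Relation.Binary.Construct.Flip.EqAndOrd as Flip
import Relation.Binary.Construct.On as On
open import Relation.Binary.Definitions using (DecidableEquality)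
open import Relation.Binary.PropositionalEquality
  using (_≡_; _≢_; refl; sym; trans; cong; subst; setoid; module ≡-Reasoning)
open import Relation.Nullary using (¬_; yes; no)
open import Relation.Nullary.Decidable using (does; dec-true; ¬?)
open import Relation.Unary using (Pred; Decidable)

open import Defs

module _ {n ℓ} {P : Pred (Fin n) ℓ} (P? : Decidable P) where

  subsetOf : Subset n
  subsetOf = Vec.tabulate (does ∘ P?)

  ∈-subsetOf⁺ : ∀ {x} → P x → x ∈ₛ subsetOf
  ∈-subsetOf⁺ {x} Px = lookup⇒[]= x subsetOf (trans (lookup∘tabulate (does ∘ P?) x) (dec-true (P? x) Px))

  ∈-subsetOf⁻ : ∀ {x} → x ∈ₛ subsetOf → P x
  ∈-subsetOf⁻ {x} x∈ with P? x | trans (sym (lookup∘tabulate (does ∘ P?) x)) ([]=⇒lookup x∈)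
  ... | yes Px | _  = Px
  ... | no  _  | ()

_≟ₛ_ : ∀ {n} → DecidableEquality (Subset n)
_≟ₛ_ = ≡-dec Bool._≟_

pointwise-map : ∀ {A B : Set} {R : A → B → Set} {f : A → B} →
                (∀ x → R x (f x)) → ∀ xs → Pointwise R xs (List.map f xs)
pointwise-map Rf []       = []
pointwise-map Rf (x ∷ xs) = Rf x ∷ pointwise-map Rf xs

module _ {n} (G : Graph n) {A : Set} (f : A → ℕ) where

  ≤-head : ∀ {x c cs} → Linked _≥_ (List.map f (c ∷ cs)) → x ∈ c ∷ cs → f x ≤ f c
  ≤-head _                        (here refl) = ≤-refl
  ≤-head {cs = _ ∷ _} (c≥d ∷ desc) (there x∈)  = ≤-trans (≤-head desc x∈) c≥d

  -- Only the first two entries of a decreasing list can exceed its third.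
  ≤-third : ∀ {xs x y z m} → Linked _≥_ (List.map f xs) → x ∈ xs → y ∈ xs → z ∈ xs →
            x ≢ y → x ≢ z → y ≢ z → m ≤ f x → m ≤ f y → m ≤ f z → m ≤ third G (List.map f xs)
  ≤-third {_ ∷ _ ∷ _ ∷ _} (_ ∷ _ ∷ desc) (there (there x∈)) _ _ _ _ _ m≤x _ _ = ≤-trans m≤x (≤-head desc x∈)
  ≤-third {_ ∷ _ ∷ _ ∷ _} (_ ∷ _ ∷ desc) _ (there (there y∈)) _ _ _ _ _ m≤y _ = ≤-trans m≤y (≤-head desc y∈)
  ≤-third {_ ∷ _ ∷ _ ∷ _} (_ ∷ _ ∷ desc) _ _ (there (there z∈)) _ _ _ _ _ m≤z = ≤-trans m≤z (≤-head desc z∈)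
  ≤-third _ (here refl)         (here refl)         _ x≢y _ _ _ _ _ = ⊥-elim (x≢y refl)
  ≤-third _ (there (here refl)) (there (here refl)) _ x≢y _ _ _ _ _ = ⊥-elim (x≢y refl)
  ≤-third _ (here refl)         (there (here refl)) (here refl)         _ x≢z _ _ _ _ = ⊥-elim (x≢z refl)
  ≤-third _ (here refl)         (there (here refl)) (there (here refl)) _ _ y≢z _ _ _ = ⊥-elim (y≢z refl)
  ≤-third _ (there (here refl)) (here refl)         (here refl)         _ _ y≢z _ _ _ = ⊥-elim (y≢z refl)
  ≤-third _ (there (here refl)) (here refl)         (there (here refl)) _ x≢z _ _ _ _ = ⊥-elim (x≢z refl)

lastOf : ∀ {n} → Fin n → List (Fin n) → Fin n
lastOf y []       = y
lastOf y (z ∷ zs) = lastOf z zs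

module Walks {n : ℕ} (G : Graph n) where

  open import Data.List.Membership.DecPropositional (_≟ᶠ_ {n}) using (_∈?_)

  infix 4 _⇝_
  _⇝_ : Fin n → Fin n → Set
  _⇝_ = Star (Adj G)

  visits : ∀ {u x} → u ⇝ x → List (Fin n)
  visits ε                 = []
  visits (_◅_ {j = w} _ p) = w ∷ visits p

  vertices : ∀ {u x} → u ⇝ x → List (Fin n)
  vertices {u} p = u ∷ visits p

  length : ∀ {u x} → u ⇝ x → ℕ
  length ε       = 0
  length (_ ◅ p) = suc (length p)

  chain : ∀ {u x} (p : u ⇝ x) → Chain G (vertices p)
  chain ε       = one
  chain (e ◅ p) = cons e (chain p)

  lastOf-visits : ∀ {u x} (p : u ⇝ x) → lastOf u (visits p) ≡ x
  lastOf-visits ε       = refl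
  lastOf-visits (_ ◅ p) = lastOf-visits p

  end∈vertices : ∀ {u x} (p : u ⇝ x) → x ∈ vertices p
  end∈vertices ε       = here refl
  end∈vertices (_ ◅ p) = there (end∈vertices p)

  length-vertices : ∀ {u x} (p : u ⇝ x) → List.length (vertices p) ≡ suc (length p)
  length-vertices ε       = refl
  length-vertices (_ ◅ p) = cong suc (length-vertices p)

  length≡0⇒≡ : ∀ {u x} (p : u ⇝ x) → length p ≡ 0 → u ≡ x
  length≡0⇒≡ ε _ = refl

  vertices≡⇒length≡ : ∀ {u x} {p q : u ⇝ x} → vertices p ≡ vertices q → length p ≡ length q
  vertices≡⇒length≡ {p = p} {q} same = suc-injective (begin
    suc (length p)           ≡⟨ length-vertices p ⟨
    List.length (vertices p) ≡⟨ cong List.length same ⟩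
    List.length (vertices q) ≡⟨ length-vertices q ⟩
    suc (length q)           ∎)
    where open ≡-Reasoning

  length-◅◅ : ∀ {u x y} (p : u ⇝ x) (q : x ⇝ y) → length (p ◅◅ q) ≡ length p + length q
  length-◅◅ ε       q = refl
  length-◅◅ (_ ◅ p) q = cong suc (length-◅◅ p q)

  ∈-◅◅⁻ : ∀ {u x y z} (p : u ⇝ x) (q : x ⇝ y) →
          z ∈ vertices (p ◅◅ q) → z ∈ vertices p ⊎ z ∈ vertices q
  ∈-◅◅⁻ ε       q z∈       = inj₂ z∈
  ∈-◅◅⁻ (_ ◅ p) q (here e) = inj₁ (here e)
  ∈-◅◅⁻ (_ ◅ p) q (there z∈) with ∈-◅◅⁻ p q z∈
  ... | inj₁ z∈p = inj₁ (there z∈p)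
  ... | inj₂ z∈q = inj₂ z∈q

  ∈-◅◅⁺ˡ : ∀ {u x y z} (p : u ⇝ x) (q : x ⇝ y) → z ∈ vertices p → z ∈ vertices (p ◅◅ q)
  ∈-◅◅⁺ˡ ε       q (here e)   = here e
  ∈-◅◅⁺ˡ (_ ◅ p) q (here e)   = here e
  ∈-◅◅⁺ˡ (_ ◅ p) q (there z∈) = there (∈-◅◅⁺ˡ p q z∈)

  ∈-◅◅⁺ʳ : ∀ {u x y z} (p : u ⇝ x) (q : x ⇝ y) → z ∈ vertices q → z ∈ vertices (p ◅◅ q)
  ∈-◅◅⁺ʳ ε       q z∈ = z∈
  ∈-◅◅⁺ʳ (_ ◅ p) q z∈ = there (∈-◅◅⁺ʳ p q z∈)

  Unique-◅◅⁻ʳ : ∀ {u x y} (p : u ⇝ x) (q : x ⇝ y) →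
                Unique (vertices (p ◅◅ q)) → Unique (vertices q)
  Unique-◅◅⁻ʳ ε       q uniq       = uniq
  Unique-◅◅⁻ʳ (_ ◅ p) q (_ ∷ uniq) = Unique-◅◅⁻ʳ p q uniq

  Unique-◅◅⁺ : ∀ {u x y} (p : u ⇝ x) (q : x ⇝ y) → Unique (vertices p) → Unique (vertices q) →
               (∀ {z} → z ∈ vertices p → z ∈ vertices q → z ≡ x) → Unique (vertices (p ◅◅ q))
  Unique-◅◅⁺ ε               q _                   uq shared = uq
  Unique-◅◅⁺ (_◅_ {i = u} _ p) q (u∉p ∷ up) uq shared =
    ¬Any⇒All¬ _ u∉p◅◅q ∷ Unique-◅◅⁺ p q up uq (shared ∘ there)
    where
    u∉p◅◅q : u ∉ vertices (p ◅◅ q)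
    u∉p◅◅q u∈ with ∈-◅◅⁻ p q u∈
    ... | inj₁ u∈p = All¬⇒¬Any u∉p u∈p
    ... | inj₂ u∈q =
      All¬⇒¬Any u∉p (subst (_∈ vertices p) (sym (shared (here refl) u∈q)) (end∈vertices p))

  reverse′ : ∀ {u x} → u ⇝ x → x ⇝ u
  reverse′ = reverse (symm G)

  ∈-revApp⁻ : ∀ {u x y z} (p : x ⇝ u) (q : x ⇝ y) →
              z ∈ vertices (revApp (symm G) p q) → z ∈ vertices p ⊎ z ∈ vertices q
  ∈-revApp⁻ ε       q z∈ = inj₂ z∈
  ∈-revApp⁻ (e ◅ p) q z∈ with ∈-revApp⁻ p (symm G e ◅ q) z∈
  ... | inj₁ z∈p         = inj₁ (there z∈p)
  ... | inj₂ (here e)    = inj₁ (there (here e))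
  ... | inj₂ (there z∈q) = inj₂ z∈q

  length-revApp : ∀ {u x y} (p : x ⇝ u) (q : x ⇝ y) → length (revApp (symm G) p q) ≡ length p + length q
  length-revApp ε       q = refl
  length-revApp (e ◅ p) q = trans (length-revApp p (symm G e ◅ q)) (+-suc (length p) (length q))

  vertices-reverse⊆ : ∀ {u x} (p : u ⇝ x) → vertices (reverse′ p) ⊆ vertices p
  vertices-reverse⊆ p z∈ with ∈-revApp⁻ p ε z∈
  ... | inj₁ z∈p         = z∈p
  ... | inj₂ (here refl) = here refl

  length-reverse : ∀ {u x} (p : u ⇝ x) → length (reverse′ p) ≡ length p
  length-reverse p = trans (length-revApp p ε) (+-identityʳ (length p))

  split : ∀ {u x z} (p : u ⇝ x) → z ∈ vertices p →
          ∃₂ λ (p₁ : u ⇝ z) (p₂ : z ⇝ x) → p ≡ p₁ ◅◅ p₂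
  split p       (here refl) = ε , p , refl
  split (e ◅ p) (there z∈) with split p z∈
  ... | p₁ , p₂ , refl = e ◅ p₁ , p₂ , refl

  record Shortcut {u x} (p : u ⇝ x) : Set where
    field
      walk    : u ⇝ x
      unique  : Unique (vertices walk)
      ⊆p      : vertices walk ⊆ vertices p
      shorter : length walk ≤ length p

  shortcut-◅ : ∀ {u w x} (e : Adj G u w) {p : w ⇝ x} → Shortcut p → Shortcut (e ◅ p)
  shortcut-◅ {u} e record { walk = q ; unique = uq ; ⊆p = q⊆p ; shorter = q≤p } with u ∈? vertices q
  ... | no u∉q = record
    { walk    = e ◅ q
    ; unique  = ¬Any⇒All¬ _ u∉q ∷ uq
    ; ⊆p      = λ { (here e) → here e ; (there z∈) → there (q⊆p z∈) }
    ; shorter = s≤s q≤p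
    }
  ... | yes u∈q with split q u∈q
  ...   | q₁ , q₂ , refl = record
    { walk    = q₂
    ; unique  = Unique-◅◅⁻ʳ q₁ q₂ uq
    ; ⊆p      = there ∘ q⊆p ∘ ∈-◅◅⁺ʳ q₁ q₂
    ; shorter = m≤n⇒m≤1+n (≤-trans (m≤n+m _ (length q₁))
                                    (≤-trans (≤-reflexive (sym (length-◅◅ q₁ q₂))) q≤p))
    }

  shortcut : ∀ {u x} (p : u ⇝ x) → Shortcut p
  shortcut ε       = record { walk = ε ; unique = [] ∷ [] ; ⊆p = id ; shorter = z≤n }
  shortcut (e ◅ p) = shortcut-◅ e (shortcut p)

  fromWalkIn : ∀ {P u x k} → WalkIn G P u x k → Σ (u ⇝ x) λ p → All P (vertices p) × length p ≡ k
  fromWalkIn (here Pu) = ε , Pu ∷ [] , refl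
  fromWalkIn (step Pu e r) with fromWalkIn r
  ... | p , Pp , refl = e ◅ p , Pu ∷ Pp , refl

  toWalkIn : ∀ {P u x} (p : u ⇝ x) → All P (vertices p) → WalkIn G P u x (length p)
  toWalkIn ε       (Pu ∷ []) = here Pu
  toWalkIn (e ◅ p) (Pu ∷ Pp) = step Pu e (toWalkIn p Pp)

addEdge : ∀ {n} (G : Graph n) {w y : Fin n} → w ≢ y → Graph n
addEdge {n} G {w} {y} w≢y = record { Adj = Adj′ ; symm = symm′ ; irrefl = irrefl′ }
  where
  Adj′ : Fin n → Fin n → Set
  Adj′ p q = Adj G p q ⊎ (p ≡ w × q ≡ y) ⊎ (p ≡ y × q ≡ w)
  symm′ : ∀ {p q} → Adj′ p q → Adj′ q p
  symm′ (inj₁ e)                 = inj₁ (symm G e)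
  symm′ (inj₂ (inj₁ (p≡ , q≡))) = inj₂ (inj₂ (q≡ , p≡))
  symm′ (inj₂ (inj₂ (p≡ , q≡))) = inj₂ (inj₁ (q≡ , p≡))
  irrefl′ : ∀ {p} → ¬ Adj′ p p
  irrefl′ (inj₁ e)                 = irrefl G e
  irrefl′ (inj₂ (inj₁ (p≡w , p≡y))) = w≢y (trans (sym p≡w) p≡y)
  irrefl′ (inj₂ (inj₂ (p≡y , p≡w))) = w≢y (trans (sym p≡w) p≡y)

Chain-mono : ∀ {n} {G H : Graph n} → (∀ {p q} → Adj G p q → Adj H p q) →
             ∀ {vs} → Chain G vs → Chain H vs
Chain-mono G⊆H nil        = nil
Chain-mono G⊆H one        = one
Chain-mono G⊆H (cons e c) = cons (G⊆H e) (Chain-mono G⊆H c)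

-- IsCycle reads its closing vertex off a local function of Defs that cannot be named here. That
-- function ignores the graph, so a long cycle is closed by recursing on the shorter cycle through
-- the chord w y, in the graph with that chord added.
close-cycle : ∀ {n} (G : Graph n) {u w x} vs → Unique (u ∷ w ∷ x ∷ vs) → Chain G (u ∷ w ∷ x ∷ vs) →
              Adj G (lastOf x vs) u → IsCycle G (u ∷ w ∷ x ∷ vs)
close-cycle G []       uniq ch closing = (uniq , ch) , closing
close-cycle G (y ∷ ys) uniq@((u≢w ∷ _ ∷ u≢y ∷ u∉ys) ∷ (_ ∷ w≢y ∷ w∉ys) ∷ (_ ∷ uniq-y))
                       ch@(cons uw (cons _ (cons _ ch-y))) closing =
  (uniq , ch) , fromChorded (proj₂ shorter)
  where
  chorded : Graph _
  chorded = addEdge G w≢y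
  shorter : IsCycle chorded (_ ∷ _ ∷ y ∷ ys)
  shorter = close-cycle chorded ys ((u≢w ∷ u≢y ∷ u∉ys) ∷ (w≢y ∷ w∉ys) ∷ uniq-y)
              (cons (inj₁ uw) (cons (inj₂ (inj₁ (refl , refl))) (Chain-mono inj₁ ch-y))) (inj₁ closing)
  fromChorded : ∀ {z} → Adj chorded z _ → Adj G z _
  fromChorded (inj₁ e)                = e
  fromChorded (inj₂ (inj₁ (_ , u≡y))) = ⊥-elim (u≢y u≡y)
  fromChorded (inj₂ (inj₂ (_ , u≡w))) = ⊥-elim (u≢w u≡w)

module Tree {n : ℕ} (T : Graph n) (connected : Connected T) (acyclic : ∀ vs → ¬ IsCycle T vs) where

  open Walks T
  open Shortcut
  open import Data.List.Membership.DecPropositional (_≟ᶠ_ {n}) using (_∈?_)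

  neighbours-separated : ∀ {u p q} → Adj T u p → Adj T u q → p ≢ q → (c : p ⇝ q) → u ∈ vertices c
  neighbours-separated {u} up uq p≢q c with u ∈? vertices c
  ... | yes u∈c = u∈c
  ... | no u∉c with shortcut c
  ...   | record { walk = ε } = ⊥-elim (p≢q refl)
  ...   | record { walk = e ◅ c′ ; unique = uc ; ⊆p = ⊆c } =
    ⊥-elim (acyclic _ (close-cycle T (visits c′) (¬Any⇒All¬ _ (u∉c ∘ ⊆c) ∷ uc) (cons up (chain (e ◅ c′)))
                         (subst (λ z → Adj T z u) (sym (lastOf-visits c′)) (symm T uq))))

  Unique⇒vertices≡ : ∀ {u x} (p q : u ⇝ x) → Unique (vertices p) → Unique (vertices q) →
                     vertices p ≡ vertices q
  Unique⇒vertices≡ ε       ε       _         _         = refl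
  Unique⇒vertices≡ ε       (_ ◅ q) _         (u∉q ∷ _) = ⊥-elim (All¬⇒¬Any u∉q (end∈vertices q))
  Unique⇒vertices≡ (_ ◅ p) ε       (u∉p ∷ _) _         = ⊥-elim (All¬⇒¬Any u∉p (end∈vertices p))
  Unique⇒vertices≡ (_◅_ {i = u} {j = w₁} e p) (_◅_ {j = w₂} e′ q) (u∉p ∷ up) (u∉q ∷ uq) with w₁ ≟ᶠ w₂
  ... | yes refl = cong (u ∷_) (Unique⇒vertices≡ p q up uq)
  ... | no w₁≢w₂ with ∈-◅◅⁻ p (reverse′ q) (neighbours-separated e e′ w₁≢w₂ (p ◅◅ reverse′ q))
  ...   | inj₁ u∈p = ⊥-elim (All¬⇒¬Any u∉p u∈p)
  ...   | inj₂ u∈q = ⊥-elim (All¬⇒¬Any u∉q (vertices-reverse⊆ q u∈q))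

  -- Everything below uses path only through path-unique; unfolding its construction is expensive.
  opaque
    path : (u x : Fin n) → u ⇝ x
    path u x = walk (shortcut (proj₁ (fromWalkIn (proj₂ (connected u x)))))

    path-unique : ∀ u x → Unique (vertices (path u x))
    path-unique u x = unique (shortcut (proj₁ (fromWalkIn (proj₂ (connected u x)))))

  path-canonical : ∀ {u x} (q : u ⇝ x) → Unique (vertices q) → vertices q ≡ vertices (path u x)
  path-canonical {u} {x} q uq = Unique⇒vertices≡ q (path u x) uq (path-unique u x)

  path⊆ : ∀ {u x} (q : u ⇝ x) → vertices (path u x) ⊆ vertices q
  path⊆ q {z} = ⊆p s ∘ subst (z ∈_) (sym (path-canonical (walk s) (unique s)))
    where
    s : Shortcut q
    s = shortcut q

  dist : Fin n → Fin n → ℕ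
  dist u x = length (path u x)

  dist-minimal : ∀ {u x} (q : u ⇝ x) → dist u x ≤ length q
  dist-minimal q =
    ≤-trans (≤-reflexive (vertices≡⇒length≡ (sym (path-canonical (walk s) (unique s))))) (shorter s)
    where
    s : Shortcut q
    s = shortcut q

  dist-Dist : ∀ u x → Dist T u x (dist u x)
  dist-Dist u x = toWalkIn (path u x) (All.universal (λ _ → tt) _) , minimal
    where
    minimal : ∀ k → Walk T u x k → dist u x ≤ k
    minimal k w with fromWalkIn w
    ... | q , _ , refl = dist-minimal q

  Dist⇒≡dist : ∀ {u x k} → Dist T u x k → k ≡ dist u x
  Dist⇒≡dist {u} {x} (w , minimal) =
    ≤-antisym (minimal _ (proj₁ (dist-Dist u x))) (proj₂ (dist-Dist u x) _ w)

  dist-sym : ∀ x y → dist x y ≡ dist y x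
  dist-sym x y = ≤-antisym (reversed x y) (reversed y x)
    where
    reversed : ∀ x y → dist x y ≤ dist y x
    reversed x y = ≤-trans (dist-minimal (reverse′ (path y x))) (≤-reflexive (length-reverse (path y x)))

  dist-triangle : ∀ x y z → dist x z ≤ dist x y + dist y z
  dist-triangle x y z =
    ≤-trans (dist-minimal (path x y ◅◅ path y z)) (≤-reflexive (length-◅◅ (path x y) (path y z)))

  dist-self : ∀ x → dist x x ≡ 0
  dist-self x = n≤0⇒n≡0 (dist-minimal ε)

  dist≡0⇒≡ : ∀ {x y} → dist x y ≡ 0 → x ≡ y
  dist≡0⇒≡ {x} {y} = length≡0⇒≡ (path x y)

  infix 4 _∈[_─_]
  _∈[_─_] : Fin n → Fin n → Fin n → Set
  w ∈[ x ─ z ] = w ∈ vertices (path x z)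

  end∈[─] : ∀ {x z} → z ∈[ x ─ z ]
  end∈[─] = end∈vertices _

  ∈[─]-sym : ∀ {w x z} → w ∈[ x ─ z ] → w ∈[ z ─ x ]
  ∈[─]-sym {x = x} {z} = vertices-reverse⊆ (path z x) ∘ path⊆ (reverse′ (path z x))

  ∈[─]-split : ∀ {w x z} y → w ∈[ x ─ z ] → w ∈[ x ─ y ] ⊎ w ∈[ y ─ z ]
  ∈[─]-split {x = x} {z} y = ∈-◅◅⁻ (path x y) (path y z) ∘ path⊆ (path x y ◅◅ path y z)

  module _ {b x z : Fin n} (b∈xz : b ∈[ x ─ z ]) where

    private
      halves : ∃₂ λ (p₁ : x ⇝ b) (p₂ : b ⇝ z) → path x z ≡ p₁ ◅◅ p₂
      halves = split (path x z) b∈xz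
      before : x ⇝ b
      before = proj₁ halves
      after : b ⇝ z
      after = proj₁ (proj₂ halves)
      joined : path x z ≡ before ◅◅ after
      joined = proj₂ (proj₂ halves)

    dist-on-path : dist x z ≡ dist x b + dist b z
    dist-on-path = ≤-antisym (dist-triangle x b z) (begin
      dist x b + dist b z          ≤⟨ +-mono-≤ (dist-minimal before) (dist-minimal after) ⟩
      length before + length after ≡⟨ sym (length-◅◅ before after) ⟩
      length (before ◅◅ after)     ≡⟨ cong length joined ⟨
      dist x z                     ∎)
      where open ≤-Reasoning

    ∈[─]-prefix : ∀ {t} → t ∈[ x ─ b ] → t ∈[ x ─ z ]
    ∈[─]-prefix = subst (λ p → _ ∈ vertices p) (sym joined) ∘ ∈-◅◅⁺ˡ before after ∘ path⊆ before

    ∈[─]-suffix : ∀ {t} → t ∈[ b ─ z ] → t ∈[ x ─ z ]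
    ∈[─]-suffix = subst (λ p → _ ∈ vertices p) (sym joined) ∘ ∈-◅◅⁺ʳ before after ∘ path⊆ after

  between-antisym : ∀ {v w y} → v ∈[ w ─ y ] → w ∈[ v ─ y ] → v ≡ w
  between-antisym {v} {w} {y} v∈wy w∈vy = dist≡0⇒≡ (m+n≡0⇒m≡0 _ (+-cancelʳ-≡ (dist v y) _ 0 round-trip))
    where
    open ≡-Reasoning
    round-trip : dist v w + dist w v + dist v y ≡ 0 + dist v y
    round-trip = begin
      dist v w + dist w v + dist v y   ≡⟨ +-assoc (dist v w) _ _ ⟩
      dist v w + (dist w v + dist v y) ≡⟨ cong (dist v w +_) (dist-on-path v∈wy) ⟨
      dist v w + dist w y              ≡⟨ dist-on-path w∈vy ⟨
      dist v y                         ∎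

  -- The junction w is the only vertex of path v w that can lie on path w a, as every other one is
  -- closer to v; so path v w ◅◅ path w a is a path, hence the path from v to a.
  nearest⇒between : ∀ {v w a} → (∀ {t} → t ∈[ w ─ a ] → dist v w ≤ dist v t) → w ∈[ v ─ a ]
  nearest⇒between {v} {w} {a} nearest =
    subst (w ∈_) (path-canonical (path v w ◅◅ path w a) simple) (∈-◅◅⁺ʳ (path v w) (path w a) (here refl))
    where
    shared≡w : ∀ {t} → t ∈[ v ─ w ] → t ∈[ w ─ a ] → t ≡ w
    shared≡w {t} t∈vw t∈wa = dist≡0⇒≡ (n≤0⇒n≡0 (+-cancelˡ-≤ (dist v t) _ 0 (begin
      dist v t + dist t w ≡⟨ dist-on-path t∈vw ⟨
      dist v w            ≤⟨ nearest t∈wa ⟩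
      dist v t            ≡⟨ +-identityʳ (dist v t) ⟨
      dist v t + 0        ∎)))
      where open ≤-Reasoning
    simple : Unique (vertices (path v w ◅◅ path w a))
    simple = Unique-◅◅⁺ (path v w) (path w a) (path-unique v w) (path-unique w a) shared≡w

  ∉[─]-extend : ∀ {w u s z} → ¬ w ∈[ u ─ s ] → (q : s ⇝ z) → w ∉ vertices q → ¬ w ∈[ u ─ z ]
  ∉[─]-extend {u = u} {s} w∉us q w∉q w∈uz with ∈-◅◅⁻ (path u s) q (path⊆ (path u s ◅◅ q) w∈uz)
  ... | inj₁ w∈us = w∉us w∈us
  ... | inj₂ w∈q  = w∉q w∈q

  ∉[─]-along : ∀ {w u s z} → ¬ w ∈[ u ─ s ] → (q : s ⇝ z) → w ∉ vertices q →
               All (λ t → ¬ w ∈[ u ─ t ]) (vertices q)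
  ∉[─]-along {w} w∉us q w∉q = All.tabulate prefix-avoids
    where
    prefix-avoids : ∀ {t} → t ∈ vertices q → ¬ w ∈[ _ ─ t ]
    prefix-avoids t∈q with split q t∈q
    ... | q₁ , q₂ , q≡ =
      ∉[─]-extend w∉us q₁ (w∉q ∘ subst (λ r → w ∈ vertices r) (sym q≡) ∘ ∈-◅◅⁺ˡ q₁ q₂)

  componentAt : Fin n → Fin n → Subset n
  componentAt w u = subsetOf (λ x → ¬? (w ∈? vertices (path u x)))

  ∈-componentAt⁺ : ∀ {w u x} → ¬ w ∈[ u ─ x ] → x ∈ₛ componentAt w u
  ∈-componentAt⁺ {w} {u} = ∈-subsetOf⁺ (λ x → ¬? (w ∈? vertices (path u x)))

  ∈-componentAt⁻ : ∀ {w u x} → x ∈ₛ componentAt w u → ¬ w ∈[ u ─ x ]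
  ∈-componentAt⁻ {w} {u} = ∈-subsetOf⁻ (λ x → ¬? (w ∈? vertices (path u x)))

  self∈componentAt : ∀ {w u} → u ≢ w → u ∈ₛ componentAt w u
  self∈componentAt u≢w = ∈-componentAt⁺ ((λ { (here w≡u) → u≢w (sym w≡u) }) ∘ path⊆ ε)

  componentAt-isComponent : ∀ {w u} → u ≢ w → IsComponent T w (componentAt w u)
  componentAt-isComponent {w} {u} u≢w =
    (u , self∈componentAt u≢w) , (λ w∈ → ∈-componentAt⁻ w∈ end∈[─]) , inside , no-exit
    where
    C : Subset n
    C = componentAt w u
    inside : ∀ a b → a ∈ₛ C → b ∈ₛ C → ∃ λ k → WalkIn T (_∈ₛ C) a b k
    inside a b a∈ b∈ = _ , toWalkIn q (All.map ∈-componentAt⁺ (∉[─]-along (∈-componentAt⁻ a∈) q w∉q))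
      where
      q : a ⇝ b
      q = reverse′ (path u a) ◅◅ path u b
      w∉q : w ∉ vertices q
      w∉q w∈q with ∈-◅◅⁻ (reverse′ (path u a)) (path u b) w∈q
      ... | inj₁ w∈au = ∈-componentAt⁻ a∈ (vertices-reverse⊆ (path u a) w∈au)
      ... | inj₂ w∈ub = ∈-componentAt⁻ b∈ w∈ub
    no-exit : ∀ a b → a ∈ₛ C → b ∉ₛ C → b ≢ w → ¬ Adj T a b
    no-exit a b a∈ b∉ b≢w ab = b∉ (∈-componentAt⁺ (∉[─]-extend (∈-componentAt⁻ a∈) (ab ◅ ε) w∉ab))
      where
      w∉ab : w ∉ a ∷ b ∷ []
      w∉ab (here w≡a)         = ∈-componentAt⁻ a∈ (subst (_∈[ u ─ a ]) (sym w≡a) end∈[─])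
      w∉ab (there (here w≡b)) = b≢w (sym w≡b)

  component-closed : ∀ {v C s z} → IsComponent T v C → s ∈ₛ C → (q : s ⇝ z) → v ∉ vertices q → z ∈ₛ C
  component-closed isC s∈ ε _ = s∈
  component-closed {C = C} isC@(_ , _ , _ , no-exit) s∈ (_◅_ {j = t} e q) v∉q with t ∈ₛ? C
  ... | yes t∈ = component-closed isC t∈ q (v∉q ∘ there)
  ... | no t∉  = ⊥-elim (no-exit _ t s∈ t∉ (λ t≡v → v∉q (there (here (sym t≡v)))) e)

  component≡componentAt : ∀ {w C u} → IsComponent T w C → u ∈ₛ C → C ≡ componentAt w u
  component≡componentAt {w} {C} {u} isC@(_ , w∉C , inside , _) u∈ = ⊆-antisym C⊆ ⊆C
    where
    C⊆ : ∀ {x} → x ∈ₛ C → x ∈ₛ componentAt w u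
    C⊆ {x} x∈ with fromWalkIn (proj₂ (inside u x u∈ x∈))
    ... | q , q⊆C , _ = ∈-componentAt⁺ (λ w∈ → w∉C (All.lookup q⊆C (path⊆ q w∈)))
    ⊆C : ∀ {x} → x ∈ₛ componentAt w u → x ∈ₛ C
    ⊆C x∈ = component-closed isC u∈ (path u _) (∈-componentAt⁻ x∈)

  component-separates : ∀ {v C w y} → IsComponent T v C → y ∈ₛ C → w ∉ₛ C → v ∈[ w ─ y ]
  component-separates {v} {w = w} {y} isC y∈ w∉ with v ∈? vertices (path w y)
  ... | yes v∈wy = v∈wy
  ... | no v∉wy  =
    ⊥-elim (w∉ (component-closed isC y∈ (reverse′ (path w y)) (v∉wy ∘ vertices-reverse⊆ (path w y))))

  module _ (w : Fin n) (C : Subset n) where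

    private
      members : List (Fin n)
      members = filter (_∈ₛ? C) (allFin n)

    farthest : Fin n
    farthest = argmax (dist w) w members

    farthest∈ : farthest ∈ₛ C ⊎ farthest ≡ w
    farthest∈ = argmax-all (dist w) {P = λ u → u ∈ₛ C ⊎ u ≡ w} (inj₂ refl)
                  (All.tabulate (inj₁ ∘ proj₂ ∘ ∈-filter⁻ (_∈ₛ? C) {xs = allFin n}))

    reach : ℕ
    reach = dist w farthest

    dist≤reach : ∀ {x} → x ∈ₛ C ⊎ x ≡ w → dist w x ≤ reach
    dist≤reach (inj₁ x∈)  =
      All.lookup (f[xs]≤f[argmax] {f = dist w} w members) (∈-filter⁺ (_∈ₛ? C) (∈-allFin _) x∈)
    dist≤reach (inj₂ refl) = f[⊥]≤f[argmax] {f = dist w} w members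

    reach-Reach : Reach T w C reach
    reach-Reach = (farthest , farthest∈ , dist-Dist w farthest)
                , λ x k x∈ wx≡k → subst (_≤ reach) (sym (Dist⇒≡dist wx≡k)) (dist≤reach x∈)

  module _ (w : Fin n) where

    open Sort (On.decTotalOrder (Flip.decTotalOrder ≤-decTotalOrder) (reach w)) using (sort; sort-↭; sort-↗)

    components : List (Subset n)
    components = sort (deduplicate _≟ₛ_ (List.map (componentAt w) (filter (λ u → ¬? (u ≟ᶠ w)) (allFin n))))

    ∈-components⁺ : ∀ {u} → u ≢ w → componentAt w u ∈ components
    ∈-components⁺ u≢w = ∈-resp-↭ (↭-sym (sort-↭ _))
      (∈-deduplicate⁺ _≟ₛ_ (∈-map⁺ (componentAt w) (∈-filter⁺ (λ u → ¬? (u ≟ᶠ w)) (∈-allFin _) u≢w)))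

    ∈-components⁻ : ∀ {C} → C ∈ components → ∃ λ u → u ≢ w × C ≡ componentAt w u
    ∈-components⁻ C∈ with ∈-map⁻ (componentAt w) (∈-deduplicate⁻ _≟ₛ_ _ (∈-resp-↭ (sort-↭ _) C∈))
    ... | u , u∈ , C≡ = u , proj₂ (∈-filter⁻ (λ u → ¬? (u ≟ᶠ w)) {xs = allFin n} u∈) , C≡

    components-sorted : Linked _≥_ (List.map (reach w) components)
    components-sorted = Linked.map⁺ (sort-↗ _)

    components-ordered : ComponentsOrdered T w components (List.map (reach w) components)
    components-ordered =
      Unique-resp-↭ (setoid _) (↭⇒↭ₛ (↭-sym (sort-↭ _))) (deduplicate-! _≟ₛ_ _) ,
      All.tabulate isComponent , complete , pointwise-map (reach-Reach w) components , components-sorted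
      where
      isComponent : ∀ {C} → C ∈ components → IsComponent T w C
      isComponent C∈ with ∈-components⁻ C∈
      ... | u , u≢w , refl = componentAt-isComponent u≢w
      complete : ∀ C → IsComponent T w C → C ∈ components
      complete C isC@((u , u∈C) , w∉C , _) =
        subst (_∈ components) (sym (component≡componentAt isC u∈C))
          (∈-components⁺ (λ u≡w → w∉C (subst (_∈ₛ C) u≡w u∈C)))

  η : Fin n → ℕ
  η w = third T (List.map (reach w) (components w))

  Eta-η : ∀ w → Eta T w (η w)
  Eta-η w = components w , _ , components-ordered w , refl

  triod⇒≤η : ∀ {w a b y} m → w ∈[ a ─ b ] → w ∈[ a ─ y ] → w ∈[ b ─ y ] →
             m ≤ dist w a → m ≤ dist w b → m ≤ dist w y → m ≤ η w
  triod⇒≤η zero _ _ _ _ _ _ = z≤n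
  triod⇒≤η {w} (suc m) w∈ab w∈ay w∈by m<a m<b m<y =
    ≤-third T (reach w) (components-sorted w)
      (∈-components⁺ w (≢w m<a)) (∈-components⁺ w (≢w m<b)) (∈-components⁺ w (≢w m<y))
      (separated (≢w m<b) w∈ab) (separated (≢w m<y) w∈ay) (separated (≢w m<y) w∈by)
      (leg m<a) (leg m<b) (leg m<y)
    where
    ≢w : ∀ {x} → suc m ≤ dist w x → x ≢ w
    ≢w m<x refl = n≮0 (subst (m <_) (dist-self w) m<x)
    separated : ∀ {x z} → z ≢ w → w ∈[ x ─ z ] → componentAt w x ≢ componentAt w z
    separated z≢w w∈xz same = ∈-componentAt⁻ (subst (_ ∈ₛ_) (sym same) (self∈componentAt z≢w)) w∈xz
    leg : ∀ {x} → suc m ≤ dist w x → suc m ≤ reach w (componentAt w x)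
    leg m<x = ≤-trans m<x (dist≤reach w _ (inj₁ (self∈componentAt (≢w m<x))))

  beyond-component : ∀ {v C r w h} → IsComponent T v C → Reach T v C r → w ∉ₛ C → h ≤ r →
                     ∃ λ y → v ∈[ w ─ y ] × h ≤ dist v y
  beyond-component isC ((y , inj₁ y∈ , vy) , _) w∉ h≤r =
    y , component-separates isC y∈ w∉ , subst (_ ≤_) (Dist⇒≡dist vy) h≤r
  beyond-component isC ((_ , inj₂ refl , vv) , _) _ h≤r = _ , end∈[─] , subst (_ ≤_) (Dist⇒≡dist vv) h≤r

  Eta⇒far-vertex : ∀ {v h} → Eta T v h → ∀ w → ∃ λ y → v ∈[ w ─ y ] × h ≤ dist v y
  Eta⇒far-vertex {v} (_ , _ , (_ , _ , _ , []          , _) , refl) w = v , end∈[─] , z≤n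
  Eta⇒far-vertex {v} (_ , _ , (_ , _ , _ , _ ∷ []      , _) , refl) w = v , end∈[─] , z≤n
  Eta⇒far-vertex {v} (_ , _ , (_ , _ , _ , _ ∷ _ ∷ [] , _) , refl) w = v , end∈[─] , z≤n
  Eta⇒far-vertex (C₁ ∷ C₂ ∷ _ , _ , ((C₁≢C₂ ∷ _) ∷ _ , isC₁ ∷ isC₂ ∷ _ , _ , R₁ ∷ R₂ ∷ _ ∷ _ , r₁≥r₂ ∷ r₂≥r₃ ∷ _)
                                  , refl) w
    with w ∈ₛ? C₁
  ... | no w∉C₁  = beyond-component isC₁ R₁ w∉C₁ (≤-trans r₂≥r₃ r₁≥r₂)
  ... | yes w∈C₁ = beyond-component isC₂ R₂ w∉C₂ r₂≥r₃
    where
    w∉C₂ : w ∉ₛ C₂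
    w∉C₂ w∈C₂ = C₁≢C₂ (trans (component≡componentAt isC₁ w∈C₁) (sym (component≡componentAt isC₂ w∈C₂)))

  far-end : ∀ {w a b y} → w ∈[ a ─ y ] → w ∈[ a ─ b ] → dist a y ≤ dist a b → dist w y ≤ dist w b
  far-end {w} {a} {b} {y} w∈ay w∈ab ay≤ab = +-cancelˡ-≤ (dist a w) _ _ (begin
    dist a w + dist w y ≡⟨ dist-on-path w∈ay ⟨
    dist a y            ≤⟨ ay≤ab ⟩
    dist a b            ≡⟨ dist-on-path w∈ab ⟩
    dist a w + dist w b ∎)
    where open ≤-Reasoning

  Diametral : Fin n → Fin n → Set
  Diametral a b = ∀ x z → dist x z ≤ dist a b

  opaque
    diametral-pair : Fin n → ∃₂ Diametral
    diametral-pair v₀ = a , eccentric a , λ x z → ≤-trans (≤eccentric x z) (most-eccentric x)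
      where
      eccentric : Fin n → Fin n
      eccentric x = argmax (dist x) x (allFin n)
      ≤eccentric : ∀ x z → dist x z ≤ dist x (eccentric x)
      ≤eccentric x z = All.lookup (f[xs]≤f[argmax] x (allFin n)) (∈-allFin z)
      a : Fin n
      a = argmax (λ x → dist x (eccentric x)) v₀ (allFin n)
      most-eccentric : ∀ x → dist x (eccentric x) ≤ dist a (eccentric a)
      most-eccentric x = All.lookup (f[xs]≤f[argmax] v₀ (allFin n)) (∈-allFin x)

  opaque
    nearest-vertex : ∀ v a b → ∃ λ w → w ∈[ a ─ b ] × (∀ {t} → t ∈[ a ─ b ] → dist v w ≤ dist v t)
    nearest-vertex v a b =
      w , [ (λ w≡a → subst (_∈[ a ─ b ]) (sym w≡a) (here refl)) , id ]′ (argmin-sel (dist v) a ab)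
        , All.lookup (f[argmin]≤f[xs] {f = dist v} a ab)
      where
      ab : List (Fin n)
      ab = vertices (path a b)
      w : Fin n
      w = argmin (dist v) a ab

  triod-off-diameter : ∀ {a b v h w} → Diametral a b → Eta T v h → w ∈[ a ─ b ] →
                       (∀ {t} → t ∈[ a ─ b ] → dist v w ≤ dist v t) → w ≢ v → suc h ≤ η w
  triod-off-diameter {a} {b} {v} {h} {w} diametral ηv w∈ab nearest w≢v with Eta⇒far-vertex ηv w
  ... | y , v∈wy , h≤vy =
    triod⇒≤η (suc h) w∈ab w∈ay w∈by (≤-trans h<wy wy≤wa) (≤-trans h<wy wy≤wb) h<wy
    where
    w∉vy : ¬ w ∈[ v ─ y ]
    w∉vy w∈vy = w≢v (sym (between-antisym v∈wy w∈vy))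
    towards-y : ∀ {x} → w ∈[ v ─ x ] → w ∈[ x ─ y ]
    towards-y w∈vx = [ ⊥-elim ∘ w∉vy , ∈[─]-sym ]′ (∈[─]-split y w∈vx)
    w∈ay : w ∈[ a ─ y ]
    w∈ay = towards-y (nearest⇒between (nearest ∘ ∈[─]-prefix w∈ab ∘ ∈[─]-sym))
    w∈by : w ∈[ b ─ y ]
    w∈by = towards-y (nearest⇒between (nearest ∘ ∈[─]-suffix w∈ab))
    h<wy : suc h ≤ dist w y
    h<wy = begin
      1 + h               ≤⟨ +-mono-≤ (n≢0⇒n>0 (w≢v ∘ dist≡0⇒≡)) h≤vy ⟩
      dist w v + dist v y ≡⟨ dist-on-path v∈wy ⟨
      dist w y            ∎
      where open ≤-Reasoning
    wy≤wb : dist w y ≤ dist w b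
    wy≤wb = far-end w∈ay w∈ab (diametral a y)
    wy≤wa : dist w y ≤ dist w a
    wy≤wa = far-end w∈by (∈[─]-sym w∈ab) (subst (dist b y ≤_) (dist-sym a b) (diametral b y))

  Eta-maximisers-on-diameter : ∀ {a b h} → Diametral a b → (∀ v k → Eta T v k → k ≤ h) →
                               ∀ {v} → Eta T v h → v ∈[ a ─ b ]
  Eta-maximisers-on-diameter {a} {b} diametral η≤h {v} ηv with v ∈? vertices (path a b)
  ... | yes v∈ab = v∈ab
  ... | no  v∉ab with nearest-vertex v a b
  ...   | w , w∈ab , nearest =
    ⊥-elim (<⇒≱ (triod-off-diameter diametral ηv w∈ab nearest w≢v) (η≤h w (η w) (Eta-η w)))
    where
    w≢v : w ≢ v
    w≢v w≡v = v∉ab (subst (_∈[ a ─ b ]) w≡v w∈ab)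

lemma3p1 : ∀ (n : ℕ) (T : Graph n) → IsTree T → ∀ (h : ℕ) → TriodSize T h →
    ∃ λ (P : List (Fin n)) → IsPath T P × (∀ v → Eta T v h → v ∈ P)
lemma3p1 n T (v₀ , connected , acyclic) h (_ , η≤h) with Tree.diametral-pair T connected acyclic v₀
... | a , b , diametral =
  vertices (path a b) , (path-unique a b , chain (path a b)) , λ v → Eta-maximisers-on-diameter diametral η≤h
  where
  open Walks T
  open Tree T connected acyclic
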